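{- The assignment $S\mapsto \mathbf{H}(S)$ on objects and $\varphi\mapsto \mathbf{H}(\varphi)$ (restriction of $\varphi$ to $S$) on morphisms is a functor from the category of finite association schemes with admissible morphisms to the category of finite hypergroups with hypergroup homomorphisms.
   Context: For a nonempty set $X$: $1_X=\{(x,x):x\in X\}$; for $p\subseteq X\times X$, $p^*=\{(a,b):(b,a)\in p\}$ and $xp=\{y\in X:(x,y)\in p\}$. An association scheme on $X$ is a partition $S$ of $X\times X$ with $1_X\in S$, $p^*\in S$ whenever $p\in S$, and such that for all $p,q,r\in S$ there is a cardinal $a_{pq}^r$ with $|yp\cap zq^*|=a_{pq}^r$ for all $y\in X$, $z\in yr$; it is finite if $X$ is finite. Complex multiplication: $pq=\{r\in S:a_{pq}^r\ge1\}$. A hypergroup is a nonempty set $H$ with a map $*$ from $H\times H$ to nonempty subsets of $H$ (extended to subsets by unions) which is associative, has a unique identity $e$ ($e*x=x*e=\{x\}$), unique inverses ($e\in(f^{ -1}*f)\cap(f*f^{ -1})$), and is reversible ($c\in a*b\Rightarrow a\in c*b^{ -1}$ and $b\in a^{ -1}*c$). $\mathbf{H}(S)$ is the hypergroup $(S,\text{complex multiplication})$ with identity $1_X$. A hypergroup homomorphism is a map with $f(a*b)\subseteq f(a)*f(b)$. A morphism from $S$ on $X$ to $T$ on $Y$ is a function $f:X\cup S\to Y\cup T$ with $f(X)\subseteq Y$, $f(S)\subseteq T$ and $(f(x),f(y))\in f(p)$ whenever $(x,y)\in p\in S$; it is admissible if whenever $(f(x),y)\in f(p)$ with $x\in X,y\in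 Y,p\in S$, there is $z\in X$ with $(x,z)\in p$, $f(z)=y$. -}

module Defs where

open import Data.Nat using (ℕ; zero; suc; _+_; _≤_)
open import Data.Fin using (Fin)
open import Data.Fin.Properties using (_≟_)
open import Data.Bool using (Bool; true; false; if_then_else_; _∧_)
open import Data.Product using (Σ; ∃; _×_; _,_; proj₁; proj₂)
open import Relation.Nullary using (⌊_⌋)
open import Relation.Binary.PropositionalEquality using (_≡_)
open import Function using (_∘_)

_⇔_ : Set → Set → Set
A ⇔ B = (A → B) × (B → A)
infix 3 _⇔_

count : ∀ {n} → (Fin n → Bool) → ℕ
count {zero}  f = 0
count {suc n} f = (if f Fin.zero then 1 else 0) + count (f ∘ Fin.suc)

-- | y p ∩ z q* |  where the relation classes are given by labels:
-- x ∈ y p  iff  rel y x = p ;  x ∈ z q*  iff  (z , x) ∈ q*  iff  rel x z = q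
intersectionCount : ∀ {n m} → (Fin n → Fin n → Fin m) →
                    Fin m → Fin m → Fin n → Fin n → ℕ
intersectionCount rel p q y z =
  count (λ x → ⌊ rel y x ≟ p ⌋ ∧ ⌊ rel x z ≟ q ⌋)

-- X = Fin n (nonempty), the partition S of
-- X × X is given by a surjective labelling  rel : X → X → Fin m  (the class
-- of (x , y) is  rel x y ; distinct labels = distinct (nonempty) blocks).
record AssociationScheme : Set where
  field
    n m        : ℕ
    X-nonempty : 1 ≤ n
    rel        : Fin n → Fin n → Fin m
    rel-surj   : ∀ p → ∃ λ (xy : Fin n × Fin n) → rel (proj₁ xy) (proj₂ xy) ≡ p
    one        : Fin m
    one-spec   : ∀ x y → (rel x y ≡ one ⇔ x ≡ y)
    star       : Fin m → Fin m
    star-spec  : ∀ p x y → (rel x y ≡ p ⇔ rel y x ≡ star p)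
    a          : Fin m → Fin m → Fin m → ℕ
    a-spec     : ∀ p q r y z → rel y z ≡ r → intersectionCount rel p q y z ≡ a p q r

open AssociationScheme public

-- Hypergroups: a hyperoperation on H is given by its membership relation,
-- Mult a b c  meaning  c ∈ a * b.
record IsHypergroup {H : Set} (Mult : H → H → H → Set) : Set where
  field
    nonempty   : ∀ a b → ∃ λ c → Mult a b c
    -- (a * b) * c = a * (b * c)  (products extended to subsets by unions)
    assoc      : ∀ a b c d → ((∃ λ x → Mult a b x × Mult x c d) ⇔ (∃ λ y → Mult b c y × Mult a y d))
    e          : H
    identityˡ  : ∀ x y → (Mult e x y ⇔ y ≡ x)
    identityʳ  : ∀ x y → (Mult x e y ⇔ y ≡ x)
    identity-unique : ∀ e′ → (∀ x y → (Mult e′ x y ⇔ y ≡ x)) →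
                      (∀ x y → (Mult x e′ y ⇔ y ≡ x)) → e′ ≡ e
    inv        : H → H
    inv-spec   : ∀ f → Mult (inv f) f e × Mult f (inv f) e
    inv-unique : ∀ f g → Mult g f e → Mult f g e → g ≡ inv f
    reversible : ∀ a b c → Mult a b c → Mult c (inv b) a × Mult (inv a) c b

IsHypergroupHom : {H K : Set} → (H → H → H → Set) → (K → K → K → Set) → (H → K) → Set
IsHypergroupHom MultH MultK f = ∀ a b c → MultH a b c → MultK (f a) (f b) (f c)

HMult : (S : AssociationScheme) → Fin (m S) → Fin (m S) → Fin (m S) → Set
HMult S p q r = 1 ≤ a S p q r

-- Morphisms of association schemes (f split into its parts on X and on S)
record Morphism (S T : AssociationScheme) : Set where
  field
    fX : Fin (n S) → Fin (n T)
    fS : Fin (m S) → Fin (m T)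
    preserves : ∀ x y → rel T (fX x) (fX y) ≡ fS (rel S x y)

open Morphism public

Admissible : {S T : AssociationScheme} → Morphism S T → Set
Admissible {S} {T} φ =
  ∀ x y p → rel T (fX φ x) y ≡ fS φ p → ∃ λ z → rel S x z ≡ p × fX φ z ≡ y

idMor : (S : AssociationScheme) → Morphism S S
idMor S = record { fX = λ x → x ; fS = λ p → p ; preserves = λ x y → Relation.Binary.PropositionalEquality.refl }

_∘M_ : {S T U : AssociationScheme} → Morphism T U → Morphism S T → Morphism S U
_∘M_ {S} {T} {U} ψ φ = record
  { fX = fX ψ ∘ fX φ
  ; fS = fS ψ ∘ fS φ
  ; preserves = λ x y → Relation.Binary.PropositionalEquality.trans
        (preserves ψ (fX φ x) (fX φ y))
        (Relation.Binary.PropositionalEquality.cong (fS ψ) (preserves φ x y)) }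

Hmap : {S T : AssociationScheme} → Morphism S T → Fin (m S) → Fin (m T)
Hmap φ = fS φ

-- An r-edge (y , z) lies on a triangle y → x → z with colours p, q exactly
-- when the count  a_{pq}^r = |yp ∩ zq*|  is positive; since that count does not
-- depend on the chosen r-edge, r ∈ pq holds iff some triangle with colours
-- (p , q , r) exists, and then every r-edge lies on one.  Each hypergroup axiom
-- of H(S) is thereby a statement about triangles, proved by relabelling
-- vertices of one triangle or gluing two along a common edge.  A morphism maps
-- triangles to triangles, so H(φ) is a homomorphism even without admissibility,
-- and functoriality holds definitionally.
module Submission where

open import Defs
open import Data.Bool using (Bool; true; false; T)
open import Data.Bool.Properties using (T-≡; T-∧)
open import Data.Empty using (⊥-elim)
open import Data.Fin using (Fin; zero; suc)
open import Data.Fin.Properties using (_≟_)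
open import Data.Nat using (ℕ; _≤_; z≤n; s≤s)
open import Data.Product using (∃; _×_; _,_; proj₁; proj₂)
open import Function using (_∘_; Equivalence)
open import Relation.Nullary.Decidable using (toWitness; fromWitness)
open import Relation.Binary.PropositionalEquality using (_≡_; refl; sym; trans; cong; subst)

count-positive⇒witness : ∀ {n} (f : Fin n → Bool) → 1 ≤ count f → ∃ λ i → T (f i)
count-positive⇒witness {ℕ.suc n} f pos with f zero in eq
... | true  = zero , Equivalence.from T-≡ eq
... | false with count-positive⇒witness (f ∘ suc) pos
...   | i , fi = suc i , fi

witness⇒count-positive : ∀ {n} (f : Fin n → Bool) (i : Fin n) → T (f i) → 1 ≤ count f
witness⇒count-positive {ℕ.suc n} f i fi with f zero in eq
... | true = s≤s z≤n
witness⇒count-positive {ℕ.suc n} f zero    fi | false = ⊥-elim (subst T eq fi)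
witness⇒count-positive {ℕ.suc n} f (suc i) fi | false = witness⇒count-positive (f ∘ suc) i fi

module _ (S : AssociationScheme) where

  private
    Colour = Fin (m S)
    Point  = Fin (n S)
    _·_∈_ = HMult S

  record Triangle (p q r : Colour) : Set where
    constructor triangle
    field
      {y x z} : Point
      yx : rel S y x ≡ p
      xz : rel S x z ≡ q
      yz : rel S y z ≡ r

  rel-star : ∀ {x y p} → rel S x y ≡ p → rel S y x ≡ star S p
  rel-star {x} {y} {p} = proj₁ (star-spec S p x y)

  rel-one⇒≡ : ∀ {x y} → rel S x y ≡ one S → x ≡ y
  rel-one⇒≡ {x} {y} = proj₁ (one-spec S x y)

  rel-refl : ∀ x → rel S x x ≡ one S
  rel-refl x = proj₂ (one-spec S x x) refl

  triangle⇒HMult : ∀ {p q r} → Triangle p q r → p · q ∈ r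
  triangle⇒HMult {p} {q} {r} (triangle {y} {x} {z} yx xz yz) =
    subst (1 ≤_) (a-spec S p q r y z yz)
      (witness⇒count-positive _ x (Equivalence.from T-∧
        (fromWitness {a? = rel S y x ≟ p} yx , fromWitness {a? = rel S x z ≟ q} xz)))

  HMult⇒apex : ∀ {p q r y z} → p · q ∈ r → rel S y z ≡ r → ∃ λ x → rel S y x ≡ p × rel S x z ≡ q
  HMult⇒apex {p} {q} {r} {y} {z} pqr yz
    with count-positive⇒witness _ (subst (1 ≤_) (sym (a-spec S p q r y z yz)) pqr)
  ... | x , apex with Equivalence.to T-∧ apex
  ...   | yx , xz = x , toWitness {a? = rel S y x ≟ p} yx , toWitness {a? = rel S x z ≟ q} xz

  HMult⇒triangle : ∀ {p q r} → p · q ∈ r → Triangle p q r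
  HMult⇒triangle {r = r} pqr with rel-surj S r
  ... | (y , z) , yz with HMult⇒apex pqr yz
  ...   | x , yx , xz = triangle yx xz yz

  ∃-successor : ∀ x p → ∃ λ w → rel S x w ≡ p
  ∃-successor x p with rel-surj S p
  ... | (u , v) , uv with HMult⇒apex (triangle⇒HMult (triangle uv (rel-star uv) (rel-refl u))) (rel-refl x)
  ...   | w , xw , _ = w , xw

  HMult-nonempty : ∀ p q → ∃ λ r → p · q ∈ r
  HMult-nonempty p q with rel-surj S p
  ... | (y , x) , yx with ∃-successor x q
  ...   | z , xz = rel S y z , triangle⇒HMult (triangle yx xz refl)

  HMult-assoc : ∀ p q t d →
    (∃ λ s → p · q ∈ s × s · t ∈ d) ⇔ (∃ λ u → q · t ∈ u × p · u ∈ d)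
  HMult-assoc p q t d = to , from
    where
    to : (∃ λ s → p · q ∈ s × s · t ∈ d) → ∃ λ u → q · t ∈ u × p · u ∈ d
    to (_ , pqs , std) with HMult⇒triangle std
    ... | triangle {w} {y} {z} wy yz wz with HMult⇒apex pqs wy
    ...   | x , wx , xy = rel S x z , triangle⇒HMult (triangle xy yz refl)
                                     , triangle⇒HMult (triangle wx refl wz)
    from : (∃ λ u → q · t ∈ u × p · u ∈ d) → ∃ λ s → p · q ∈ s × s · t ∈ d
    from (_ , qtu , pud) with HMult⇒triangle pud
    ... | triangle {w} {x} {z} wx xz wz with HMult⇒apex qtu xz
    ...   | y , xy , yz = rel S w y , triangle⇒HMult (triangle wx xy refl)
                                     , triangle⇒HMult (triangle refl yz wz)

  HMult-identityˡ : ∀ p r → (one S · p ∈ r ⇔ r ≡ p)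
  HMult-identityˡ p r = to , from
    where
    to : one S · p ∈ r → r ≡ p
    to pr with HMult⇒triangle pr
    ... | triangle yx xz yz with rel-one⇒≡ yx
    ...   | refl = trans (sym yz) xz
    from : r ≡ p → one S · p ∈ r
    from refl with rel-surj S r
    ... | (y , z) , yz = triangle⇒HMult (triangle (rel-refl y) yz yz)

  HMult-identityʳ : ∀ p r → (p · one S ∈ r ⇔ r ≡ p)
  HMult-identityʳ p r = to , from
    where
    to : p · one S ∈ r → r ≡ p
    to pr with HMult⇒triangle pr
    ... | triangle yx xz yz with rel-one⇒≡ xz
    ...   | refl = trans (sym yz) yx
    from : r ≡ p → p · one S ∈ r
    from refl with rel-surj S r
    ... | (y , z) , yz = triangle⇒HMult (triangle yz (rel-refl z) yz)

  HMult-identity-unique : ∀ e → (∀ p r → (e · p ∈ r ⇔ r ≡ p)) → e ≡ one S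
  HMult-identity-unique e identityˡ with HMult⇒triangle (proj₂ (identityˡ (one S) (one S)) refl)
  ... | triangle {y} yx xz yz with rel-one⇒≡ xz | rel-one⇒≡ yz
  ...   | refl | refl = trans (sym yx) (rel-refl y)

  HMult-inverse : ∀ p → star S p · p ∈ one S × p · star S p ∈ one S
  HMult-inverse p with rel-surj S p
  ... | (x , y) , xy = triangle⇒HMult (triangle (rel-star xy) xy (rel-refl y))
                     , triangle⇒HMult (triangle xy (rel-star xy) (rel-refl x))

  HMult-inverse-unique : ∀ p q → q · p ∈ one S → q ≡ star S p
  HMult-inverse-unique p q qp with HMult⇒triangle qp
  ... | triangle yx xz yz with rel-one⇒≡ yz
  ...   | refl = trans (sym yx) (rel-star xz)

  HMult-reversible : ∀ p q r → p · q ∈ r → r · star S q ∈ p × star S p · r ∈ q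
  HMult-reversible p q r pqr with HMult⇒triangle pqr
  ... | triangle yx xz yz = triangle⇒HMult (triangle yz (rel-star xz) yx)
                          , triangle⇒HMult (triangle (rel-star yx) yz xz)

  HMult-isHypergroup : IsHypergroup (HMult S)
  HMult-isHypergroup = record
    { nonempty        = HMult-nonempty
    ; assoc           = HMult-assoc
    ; e               = one S
    ; identityˡ       = HMult-identityˡ
    ; identityʳ       = HMult-identityʳ
    ; identity-unique = λ e identityˡ _ → HMult-identity-unique e identityˡ
    ; inv             = star S
    ; inv-spec        = HMult-inverse
    ; inv-unique      = λ p q qp _ → HMult-inverse-unique p q qp
    ; reversible      = HMult-reversible
    }

Hmap-isHypergroupHom : ∀ {S T} (φ : Morphism S T) → IsHypergroupHom (HMult S) (HMult T) (Hmap φ)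
Hmap-isHypergroupHom {S} {T} φ p q r pqr with HMult⇒triangle S pqr
... | triangle {y} {x} {z} yx xz yz = triangle⇒HMult T (triangle (image y x yx) (image x z xz) (image y z yz))
  where
  image : ∀ u v {s} → rel S u v ≡ s → rel T (fX φ u) (fX φ v) ≡ fS φ s
  image u v uv = trans (preserves φ u v) (cong (fS φ) uv)

corollary3p2 :
    ((S : AssociationScheme) → IsHypergroup (HMult S))
    × ((S T : AssociationScheme) (φ : Morphism S T) → Admissible φ →
         IsHypergroupHom (HMult S) (HMult T) (Hmap φ))
    × ((S : AssociationScheme) (p : Fin (m S)) → Hmap (idMor S) p ≡ p)
    × ((S T U : AssociationScheme) (φ : Morphism S T) (ψ : Morphism T U) →
         Admissible φ → Admissible ψ →
         (p : Fin (m S)) → Hmap (ψ ∘M φ) p ≡ Hmap ψ (Hmap φ p))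
corollary3p2 =
    HMult-isHypergroup
  , (λ _ _ φ _ → Hmap-isHypergroupHom φ)
  , (λ _ _ → refl)
  , (λ _ _ _ _ _ _ _ _ → refl)
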